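{- The LCP algorithm is 3-competitive for the discrete data-center optimization problem: for every instance, the cost of the schedule produced by LCP is at most $3$ times the cost of an optimal schedule.
   Context: Discrete data-center optimization problem: given $T,m\in\mathbb{N}$, $\beta>0$ and convex functions $f_1,\dots,f_T:\{0,\dots,m\}\to\mathbb{R}_{\ge0}$ (convex meaning $f_t(x+1)-f_t(x)$ nondecreasing), a schedule $X=(x_1,\dots,x_T)\in\{0,\dots,m\}^T$ with $x_0=0$ has cost $C(X)=\sum_{t=1}^T f_t(x_t)+\beta\sum_{t=1}^T(x_t-x_{t-1})^+$, $(y)^+=\max(0,y)$. In the online version $f_t$ is revealed at time $t$ and $x_t$ must be chosen then. For $\tau\in\{1,\dots,T\}$ and $X=(x_1,\dots,x_\tau)$ define $C^L_\tau(X)=\sum_{t=1}^\tau f_t(x_t)+\beta\sum_{t=1}^\tau(x_t-x_{t-1})^+$ and $C^U_\tau(X)=\sum_{t=1}^\tau f_t(x_t)+\beta\sum_{t=1}^\tau(x_{t-1}-x_t)^+$. Let $x^L_\tau$ be the smallest last component among all minimizers of $C^L_\tau$ over $\{0,\dots,m\}^\tau$, and $x^U_\tau$ the largest last component among all minimizers of $C^U_\tau$. The LCP (Lazy Capacity Provisioning) algorithm sets $x^{\mathrm{LCP}}_0=0$ and $x^{\mathrm{LCP}}_\tau=\max\{x^L_\tau,\min\{x^U_\tau,x^{\mathrm{LCP}}_{\tau-1}\}\}$ for $\tau\ge1$. -}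

module Defs where

open import Level using (Level) renaming (suc to lsuc)
open import Algebra.Bundles using (CommutativeRing)
open import Relation.Binary.Core using (Rel)
open import Relation.Binary.Structures using (IsTotalOrder)
open import Relation.Nullary using (¬_)
open import Data.Nat as ℕ using (ℕ; zero; suc; _∸_; _⊔_; _⊓_)
open import Data.Fin using (toℕ)
open import Data.Vec using (Vec; []; _∷_; last; tabulate)
open import Data.Vec.Relation.Unary.All using (All)
open import Data.Product using (Σ; _×_)
open import Relation.Binary.PropositionalEquality using (_≡_)

-- Value domain: an arbitrary totally ordered commutative ring
-- (ℝ is an instance).  Only these axioms are assumed.

record OrderedCommutativeRing (c ℓ₁ ℓ₂ : Level) : Set (lsuc (c Level.⊔ ℓ₁ Level.⊔ ℓ₂)) where
  field
    commutativeRing : CommutativeRing c ℓ₁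
  open CommutativeRing commutativeRing public
  infix 4 _≤ᴿ_
  field
    _≤ᴿ_         : Rel Carrier ℓ₂
    isTotalOrder : IsTotalOrder _≈_ _≤ᴿ_
    +-monoʳ-≤ᴿ   : ∀ {a b} c → a ≤ᴿ b → (a + c) ≤ᴿ (b + c)
    *-nonneg     : ∀ {a b} → 0# ≤ᴿ a → 0# ≤ᴿ b → 0# ≤ᴿ (a * b)

  infix 4 _<ᴿ_
  _<ᴿ_ : Carrier → Carrier → Set (ℓ₁ Level.⊔ ℓ₂)
  a <ᴿ b = (a ≤ᴿ b) × (¬ (a ≈ b))

  infixr 8 _·ᴿ_
  _·ᴿ_ : ℕ → Carrier → Carrier
  zero  ·ᴿ a = 0#
  suc n ·ᴿ a = a + (n ·ᴿ a)

module DataCenter {c ℓ₁ ℓ₂} (R : OrderedCommutativeRing c ℓ₁ ℓ₂) where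
  open OrderedCommutativeRing R

  -- f t x = f_t(x);  only t ∈ {1..T}, x ∈ {0..m} matter.
  CostFns : Set c
  CostFns = ℕ → ℕ → Carrier

  costUp : CostFns → Carrier → (t prev : ℕ) → ∀ {n} → Vec ℕ n → Carrier
  costUp f β t prev []       = 0#
  costUp f β t prev (x ∷ xs) = f t x + (x ∸ prev) ·ᴿ β + costUp f β (suc t) x xs

  costDown : CostFns → Carrier → (t prev : ℕ) → ∀ {n} → Vec ℕ n → Carrier
  costDown f β t prev []       = 0#
  costDown f β t prev (x ∷ xs) = f t x + (prev ∸ x) ·ᴿ β + costDown f β (suc t) x xs

  -- C^L_τ and C^U_τ (x_0 = 0, times 1..τ); C = C^L_T
  CL : CostFns → Carrier → ∀ {τ} → Vec ℕ τ → Carrier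
  CL f β xs = costUp f β 1 0 xs

  CU : CostFns → Carrier → ∀ {τ} → Vec ℕ τ → Carrier
  CU f β xs = costDown f β 1 0 xs

  Feasible : ℕ → ∀ {τ} → Vec ℕ τ → Set
  Feasible m xs = All (ℕ._≤ m) xs

  IsMinimizer : (∀ {τ} → Vec ℕ τ → Carrier) → ℕ → ∀ {τ} → Vec ℕ τ → Set ℓ₂
  IsMinimizer cost m {τ} X = Feasible m X × (∀ (Y : Vec ℕ τ) → Feasible m Y → cost X ≤ᴿ cost Y)

  -- x is x^L_τ for τ = suc k: smallest last component among minimisers of C^L_τ
  IsXL : CostFns → Carrier → ℕ → (k : ℕ) → ℕ → Set ℓ₂
  IsXL f β m k x =
    Σ (Vec ℕ (suc k)) (λ X → IsMinimizer (CL f β) m X × (last X ≡ x))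
    × (∀ (X : Vec ℕ (suc k)) → IsMinimizer (CL f β) m X → x ℕ.≤ last X)

  -- x is x^U_τ for τ = suc k: largest last component among minimisers of C^U_τ
  IsXU : CostFns → Carrier → ℕ → (k : ℕ) → ℕ → Set ℓ₂
  IsXU f β m k x =
    Σ (Vec ℕ (suc k)) (λ X → IsMinimizer (CU f β) m X × (last X ≡ x))
    × (∀ (X : Vec ℕ (suc k)) → IsMinimizer (CU f β) m X → last X ℕ.≤ x)

  -- convexity of f_t on {0..m}: f(x+1)-f(x) ≤ f(x+2)-f(x+1), written without subtraction
  Convex : ℕ → (ℕ → Carrier) → Set ℓ₂
  Convex m g = ∀ x → suc (suc x) ℕ.≤ m → g (suc x) + g (suc x) ≤ᴿ g x + g (suc (suc x))

  NonNeg : ℕ → (ℕ → Carrier) → Set ℓ₂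
  NonNeg m g = ∀ x → x ℕ.≤ m → 0# ≤ᴿ g x

lcp : (xL xU : ℕ → ℕ) → ℕ → ℕ
lcp xL xU zero    = 0
lcp xL xU (suc τ) = xL (suc τ) ⊔ (xU (suc τ) ⊓ lcp xL xU τ)

lcpSchedule : (xL xU : ℕ → ℕ) → (T : ℕ) → Vec ℕ T
lcpSchedule xL xU T = tabulate (λ i → lcp xL xU (suc (toℕ i)))

module Submission where

-- Write V k x for the least cost C^L of a feasible schedule of length k+1
-- whose last state is x; it satisfies a dynamic-programming recursion over
-- the previous state.  The thresholds of step k+1 are read off V k: x^L is
-- the least minimiser of V k, and since C^L = C^U + (last state)·β, x^U is
-- the largest minimiser of V k x − x·β.  Convexity of the f_t makes every
-- V k discretely convex (an exchange argument on "squeezed" pairs of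
-- schedules), hence V k is nondecreasing above x^L and grows by at most β
-- per unit below x^U.  With x the LCP state, u its total power-up and S its
-- cost so far, the invariant
--   x^L ≤ x ≤ x^U,  u·β ≤ V(x^L),  u·β + x^U·β ≤ V(x^U) + x·β,
--   S + x·β ≤ V(x) + 2u·β
-- survives every step, and at the horizon it gives S ≤ 3·V(x^L) ≤ 3·OPT.

open import Defs
open import Level using (Level)
open import Data.Nat as ℕ using (ℕ; zero; suc; _≤_; _<_; _∸_; _⊔_; _⊓_; z≤n; s≤s)
import Data.Nat.Properties as ℕₚ
open import Data.Fin using (toℕ)
open import Data.Vec using (Vec; []; _∷_; last; tabulate; _∷ʳ_; initLast; zipWith)
open import Data.Vec.Properties using (tabulate-cong)
open import Data.Vec.Relation.Unary.All using (All; []; _∷_)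
open import Data.Product using (Σ-syntax; ∃-syntax; _×_; _,_; proj₁; proj₂)
open import Data.Sum using (inj₁; inj₂)
open import Data.Empty using (⊥-elim)
open import Relation.Nullary using (¬_; yes; no)
open import Relation.Binary.PropositionalEquality as ≡ using (_≡_; cong; cong₂; subst; subst₂)
open import Relation.Binary.Bundles using (Poset)
open import Relation.Binary.Structures using (IsTotalOrder)
import Relation.Binary.Reasoning.PartialOrder as PartialOrderReasoning
import Relation.Binary.Reasoning.Setoid as SetoidReasoning
import Algebra.Solver.CommutativeMonoid as CommutativeMonoidSolver
import Algebra.Properties.CommutativeSemigroup as CommutativeSemigroupProperties

-- Truncated subtraction x ∸ y is the power-up cost of moving from y to x.
module NatLemmas where
  open import Data.Nat using (_+_)
  open ℕₚ.≤-Reasoning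

  ∸-triangle : ∀ x y z → x ∸ z ≤ (x ∸ y) + (y ∸ z)
  ∸-triangle x y z = ℕₚ.m≤n+o⇒m∸n≤o x z (begin
    x                         ≤⟨ ℕₚ.m≤n+m∸n x y ⟩
    y + (x ∸ y)               ≤⟨ ℕₚ.+-monoˡ-≤ (x ∸ y) (ℕₚ.m≤n+m∸n y z) ⟩
    z + (y ∸ z) + (x ∸ y)     ≡⟨ ℕₚ.+-assoc z (y ∸ z) (x ∸ y) ⟩
    z + ((y ∸ z) + (x ∸ y))   ≡⟨ cong (z +_) (ℕₚ.+-comm (y ∸ z) (x ∸ y)) ⟩
    z + ((x ∸ y) + (y ∸ z))   ∎)

  ∸-telescope : ∀ {x y z} → z ≤ y → y ≤ x → (x ∸ y) + (y ∸ z) ≡ x ∸ z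
  ∸-telescope {x} {y} {z} z≤y y≤x =
    ≡.trans (≡.sym (ℕₚ.+-∸-assoc (x ∸ y) z≤y)) (cong (_∸ z) (ℕₚ.m∸n+n≡m y≤x))

  -- both sides equal x ⊔ p
  m∸n+n≡n∸m+m : ∀ x p → (x ∸ p) + p ≡ (p ∸ x) + x
  m∸n+n≡n∸m+m x p with ℕₚ.≤-total p x
  ... | inj₁ p≤x rewrite ℕₚ.m≤n⇒m∸n≡0 p≤x = ℕₚ.m∸n+n≡m p≤x
  ... | inj₂ x≤p rewrite ℕₚ.m≤n⇒m∸n≡0 x≤p = ≡.sym (ℕₚ.m∸n+n≡m x≤p)

  ∸-detour : ∀ a y x → (a ∸ y) + x ≤ (x ∸ y) + ((x ∸ a) + a)
  ∸-detour a y x with ℕₚ.≤-total x a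
  ... | inj₁ x≤a = let x∸a≡0 = ℕₚ.m≤n⇒m∸n≡0 x≤a in begin
    (a ∸ y) + x                 ≡⟨ ℕₚ.+-comm (a ∸ y) x ⟩
    x + (a ∸ y)                 ≤⟨ ℕₚ.+-monoʳ-≤ x (∸-triangle a x y) ⟩
    x + ((a ∸ x) + (x ∸ y))     ≡⟨ ≡.sym (ℕₚ.+-assoc x (a ∸ x) (x ∸ y)) ⟩
    x + (a ∸ x) + (x ∸ y)       ≡⟨ cong (_+ (x ∸ y)) (ℕₚ.m+[n∸m]≡n x≤a) ⟩
    a + (x ∸ y)                 ≡⟨ ℕₚ.+-comm a (x ∸ y) ⟩
    (x ∸ y) + a                 ≡⟨ cong (λ d → (x ∸ y) + (d + a)) x∸a≡0 ⟨
    (x ∸ y) + ((x ∸ a) + a)     ∎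
  ... | inj₂ a≤x = begin
    (a ∸ y) + x                 ≤⟨ ℕₚ.+-monoˡ-≤ x (ℕₚ.∸-monoˡ-≤ y a≤x) ⟩
    (x ∸ y) + x                 ≡⟨ cong ((x ∸ y) +_) (≡.sym (ℕₚ.m∸n+n≡m a≤x)) ⟩
    (x ∸ y) + ((x ∸ a) + a)     ∎

  lcp-up-lands-on-L : ∀ {L U a} → a < L ⊔ (U ⊓ a) → L ⊔ (U ⊓ a) ≡ L
  lcp-up-lands-on-L {L} {U} {a} a<a′ with ℕₚ.⊔-sel L (U ⊓ a)
  ... | inj₁ a′≡L   = a′≡L
  ... | inj₂ a′≡U⊓a =
    ⊥-elim (ℕₚ.<⇒≱ a<a′ (subst (_≤ a) (≡.sym a′≡U⊓a) (ℕₚ.m⊓n≤n U a)))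

  lcp-down-lands-on-U : ∀ {L U a} → L ≤ U → L ⊔ (U ⊓ a) < a → L ⊔ (U ⊓ a) ≡ U
  lcp-down-lands-on-U {L} {U} {a} L≤U a′<a with ℕₚ.⊓-sel U a
  ... | inj₁ U⊓a≡U = ≡.trans (cong (L ⊔_) U⊓a≡U) (ℕₚ.m≤n⇒m⊔n≡n L≤U)
  ... | inj₂ U⊓a≡a =
    ⊥-elim (ℕₚ.<⇒≱ a′<a (subst (λ w → a ≤ L ⊔ w) (≡.sym U⊓a≡a) (ℕₚ.m≤n⊔m L a)))

  -- The squeeze of a pair (a, b): unchanged if b ≤ a, and (b − 1, a + 1)
  -- if a < b, i.e. both components move one step towards each other.
  squeeze₁ squeeze₂ : ℕ → ℕ → ℕ
  squeeze₁ a b = (b ∸ 1) ⊔ a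
  squeeze₂ a b = b ⊓ suc a

  data SqueezeCase (a : ℕ) : ℕ → Set where
    ordered : ∀ {b} → b ≤ a → SqueezeCase a b
    crossed : ∀ {b} → a ≤ b → SqueezeCase a (suc b)

  squeezeCase : ∀ a b → SqueezeCase a b
  squeezeCase a b with b ℕ.≤? a
  ... | yes b≤a = ordered b≤a
  ... | no b≰a with ℕₚ.≰⇒> b≰a
  ...   | s≤s a≤b = crossed a≤b

  squeeze₁-ordered : ∀ {a b} → b ≤ a → squeeze₁ a b ≡ a
  squeeze₁-ordered {a} {b} b≤a = ℕₚ.m≤n⇒m⊔n≡n (ℕₚ.≤-trans (ℕₚ.m∸n≤m b 1) b≤a)

  squeeze₂-ordered : ∀ {a b} → b ≤ a → squeeze₂ a b ≡ b
  squeeze₂-ordered b≤a = ℕₚ.m≤n⇒m⊓n≡m (ℕₚ.m≤n⇒m≤1+n b≤a)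

  squeeze₁-crossed : ∀ {a b} → a ≤ b → squeeze₁ a (suc b) ≡ b
  squeeze₁-crossed a≤b = ℕₚ.m≥n⇒m⊔n≡m a≤b

  squeeze₂-crossed : ∀ {a b} → a ≤ b → squeeze₂ a (suc b) ≡ suc a
  squeeze₂-crossed a≤b = ℕₚ.m≥n⇒m⊓n≡n (s≤s a≤b)

  squeeze₁-bounded : ∀ {a b m} → a ≤ m → b ≤ m → squeeze₁ a b ≤ m
  squeeze₁-bounded {a} {b} a≤m b≤m = ℕₚ.⊔-lub (ℕₚ.≤-trans (ℕₚ.m∸n≤m b 1) b≤m) a≤m

  squeeze₂-bounded : ∀ {a b m} → a ≤ m → b ≤ m → squeeze₂ a b ≤ m
  squeeze₂-bounded {a} {b} a≤m b≤m = ℕₚ.≤-trans (ℕₚ.m⊓n≤m b (suc a)) b≤m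

  -- Two instances of the convexity of z ↦ max(z, 0): moving a pair of
  -- arguments with fixed sum closer together does not increase the sum of
  -- the power-up costs.  They are the mixed cases of squeeze-switching.
  ∸-crossʳ : ∀ {x y s t} → y ≤ x → s ≤ t → (x ∸ t) + (y ∸ suc s) ≤ (x ∸ s) + (y ∸ suc t)
  ∸-crossʳ {x} {y} {s} {t} y≤x s≤t with ℕₚ.≤-total x t
  ... | inj₁ x≤t = begin
    (x ∸ t) + (y ∸ suc s)               ≡⟨ cong (_+ (y ∸ suc s)) (ℕₚ.m≤n⇒m∸n≡0 x≤t) ⟩
    y ∸ suc s                           ≤⟨ ℕₚ.∸-monoʳ-≤ y (ℕₚ.n≤1+n s) ⟩
    y ∸ s                               ≤⟨ ℕₚ.∸-monoˡ-≤ s y≤x ⟩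
    x ∸ s                               ≤⟨ ℕₚ.m≤m+n (x ∸ s) (y ∸ suc t) ⟩
    (x ∸ s) + (y ∸ suc t)               ∎
  ... | inj₂ t≤x = begin
    (x ∸ t) + (y ∸ suc s)               ≤⟨ ℕₚ.+-monoʳ-≤ (x ∸ t) (∸-triangle y (suc t) (suc s)) ⟩
    (x ∸ t) + ((y ∸ suc t) + (t ∸ s))   ≡⟨ cong ((x ∸ t) +_) (ℕₚ.+-comm (y ∸ suc t) (t ∸ s)) ⟩
    (x ∸ t) + ((t ∸ s) + (y ∸ suc t))   ≡⟨ ≡.sym (ℕₚ.+-assoc (x ∸ t) (t ∸ s) (y ∸ suc t)) ⟩
    (x ∸ t) + (t ∸ s) + (y ∸ suc t)     ≡⟨ cong (_+ (y ∸ suc t)) (∸-telescope s≤t t≤x) ⟩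
    (x ∸ s) + (y ∸ suc t)               ∎

  ∸-crossˡ : ∀ {x y s t} → x ≤ y → t ≤ s → (y ∸ s) + (suc x ∸ t) ≤ (x ∸ s) + (suc y ∸ t)
  ∸-crossˡ {x} {y} {s} {t} x≤y t≤s with ℕₚ.≤-total t (suc x)
  ... | inj₂ 1+x≤t = begin
    (y ∸ s) + (suc x ∸ t)               ≡⟨ cong ((y ∸ s) +_) (ℕₚ.m≤n⇒m∸n≡0 1+x≤t) ⟩
    (y ∸ s) + 0                         ≡⟨ ℕₚ.+-identityʳ (y ∸ s) ⟩
    y ∸ s                               ≤⟨ ℕₚ.∸-monoˡ-≤ s (ℕₚ.n≤1+n y) ⟩
    suc y ∸ s                           ≤⟨ ℕₚ.∸-monoʳ-≤ (suc y) t≤s ⟩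
    suc y ∸ t                           ≤⟨ ℕₚ.m≤n+m (suc y ∸ t) (x ∸ s) ⟩
    (x ∸ s) + (suc y ∸ t)               ∎
  ... | inj₁ t≤1+x = begin
    (y ∸ s) + (suc x ∸ t)               ≤⟨ ℕₚ.+-monoˡ-≤ (suc x ∸ t) (∸-triangle y x s) ⟩
    (y ∸ x) + (x ∸ s) + (suc x ∸ t)     ≡⟨ cong (_+ (suc x ∸ t)) (ℕₚ.+-comm (y ∸ x) (x ∸ s)) ⟩
    (x ∸ s) + (y ∸ x) + (suc x ∸ t)     ≡⟨ ℕₚ.+-assoc (x ∸ s) (y ∸ x) (suc x ∸ t) ⟩
    (x ∸ s) + ((y ∸ x) + (suc x ∸ t))   ≡⟨ cong ((x ∸ s) +_) (∸-telescope t≤1+x (s≤s x≤y)) ⟩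
    (x ∸ s) + (suc y ∸ t)               ∎

  squeeze-evaluated : ∀ {a b p q A₁ A₂ P₁ P₂ r} →
    squeeze₁ a b ≡ A₁ → squeeze₂ a b ≡ A₂ → squeeze₁ p q ≡ P₁ → squeeze₂ p q ≡ P₂ →
    (A₁ ∸ P₁) + (A₂ ∸ P₂) ≤ r →
    (squeeze₁ a b ∸ squeeze₁ p q) + (squeeze₂ a b ∸ squeeze₂ p q) ≤ r
  squeeze-evaluated ≡.refl ≡.refl ≡.refl ≡.refl h = h

  squeeze-switching : ∀ a b p q →
    (squeeze₁ a b ∸ squeeze₁ p q) + (squeeze₂ a b ∸ squeeze₂ p q) ≤ (a ∸ p) + (b ∸ q)
  squeeze-switching a b p q with squeezeCase a b | squeezeCase p q
  ... | ordered b≤a | ordered q≤p =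
    squeeze-evaluated (squeeze₁-ordered b≤a) (squeeze₂-ordered b≤a)
                      (squeeze₁-ordered q≤p) (squeeze₂-ordered q≤p) ℕₚ.≤-refl
  ... | crossed a≤b | crossed p≤q =
    squeeze-evaluated (squeeze₁-crossed a≤b) (squeeze₂-crossed a≤b)
                      (squeeze₁-crossed p≤q) (squeeze₂-crossed p≤q)
                      (ℕₚ.≤-reflexive (ℕₚ.+-comm _ (a ∸ p)))
  ... | ordered b≤a | crossed p≤q =
    squeeze-evaluated (squeeze₁-ordered b≤a) (squeeze₂-ordered b≤a)
                      (squeeze₁-crossed p≤q) (squeeze₂-crossed p≤q) (∸-crossʳ b≤a p≤q)
  ... | crossed a≤b | ordered q≤p =
    squeeze-evaluated (squeeze₁-crossed a≤b) (squeeze₂-crossed a≤b)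
                      (squeeze₁-ordered q≤p) (squeeze₂-ordered q≤p) (∸-crossˡ a≤b q≤p)

open NatLemmas

module OrderedRingLemmas {c ℓ₁ ℓ₂} (R : OrderedCommutativeRing c ℓ₁ ℓ₂) where
  open OrderedCommutativeRing R hiding (zero)
  open IsTotalOrder isTotalOrder public
    using (total) renaming (refl to ≤ᴿ-refl; trans to ≤ᴿ-trans; reflexive to ≤ᴿ-reflexive)

  poset : Poset c ℓ₁ ℓ₂
  poset = record { isPartialOrder = IsTotalOrder.isPartialOrder isTotalOrder }

  module ≤ᴿ-Reasoning = PartialOrderReasoning poset
  module +-Solver = CommutativeMonoidSolver +-commutativeMonoid
  open CommutativeSemigroupProperties +-commutativeSemigroup public
    using (xy∙z≈xz∙y; x∙yz≈y∙xz; x∙yz≈xz∙y; xy∙z≈x∙zy)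
  open ≤ᴿ-Reasoning

  +-mono-≤ᴿ : ∀ {a b c d} → a ≤ᴿ b → c ≤ᴿ d → a + c ≤ᴿ b + d
  +-mono-≤ᴿ {a} {b} {c} {d} a≤b c≤d = begin
    a + c   ≤⟨ +-monoʳ-≤ᴿ c a≤b ⟩
    b + c   ≈⟨ +-comm b c ⟩
    c + b   ≤⟨ +-monoʳ-≤ᴿ b c≤d ⟩
    d + b   ≈⟨ +-comm d b ⟩
    b + d   ∎

  +-monoˡ-≤ᴿ : ∀ {a b} c → a ≤ᴿ b → c + a ≤ᴿ c + b
  +-monoˡ-≤ᴿ c = +-mono-≤ᴿ (≤ᴿ-refl {c})

  +-cancelʳ-≤ᴿ : ∀ {a b} c → a + c ≤ᴿ b + c → a ≤ᴿ b
  +-cancelʳ-≤ᴿ {a} {b} c a+c≤b+c = begin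
    a             ≈⟨ sym (undo a) ⟩
    a + c + - c   ≤⟨ +-monoʳ-≤ᴿ (- c) a+c≤b+c ⟩
    b + c + - c   ≈⟨ undo b ⟩
    b             ∎
    where
    undo : ∀ x → x + c + - c ≈ x
    undo x = trans (+-assoc x c (- c)) (trans (+-congˡ (-‿inverseʳ c)) (+-identityʳ x))

  +-cancelˡ-≤ᴿ : ∀ {a b} c → c + a ≤ᴿ c + b → a ≤ᴿ b
  +-cancelˡ-≤ᴿ {a} {b} c c+a≤c+b =
    +-cancelʳ-≤ᴿ c (begin
      a + c   ≈⟨ +-comm a c ⟩
      c + a   ≤⟨ c+a≤c+b ⟩
      c + b   ≈⟨ +-comm c b ⟩
      b + c   ∎)

  x≤x+y : ∀ {a} b → 0# ≤ᴿ b → a ≤ᴿ a + b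
  x≤x+y {a} b 0≤b = ≤ᴿ-trans (≤ᴿ-reflexive (sym (+-identityʳ a))) (+-monoˡ-≤ᴿ a 0≤b)

  x≤y+x : ∀ {a} b → 0# ≤ᴿ b → a ≤ᴿ b + a
  x≤y+x {a} b 0≤b = ≤ᴿ-trans (x≤x+y b 0≤b) (≤ᴿ-reflexive (+-comm a b))

  +-interchange₃ : ∀ a b c d e g → (a + b + c) + (d + e + g) ≈ (a + d) + ((b + e) + (c + g))
  +-interchange₃ = +-Solver.solve 6 (λ a b c d e g →
    ((a ⊕ b) ⊕ c) ⊕ ((d ⊕ e) ⊕ g) ⊜ (a ⊕ d) ⊕ ((b ⊕ e) ⊕ (c ⊕ g))) refl
    where open +-Solver using (_⊕_; _⊜_)

  -- Reading a + b ≤ c + d as a − c ≤ d − b, such inequalities compose.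
  diff-trans : ∀ {a b c d e f} → a + b ≤ᴿ c + d → d + e ≤ᴿ b + f → a + e ≤ᴿ c + f
  diff-trans {a} {b} {c} {d} {e} {f} h₁ h₂ = +-cancelʳ-≤ᴿ b (begin
    a + e + b       ≈⟨ xy∙z≈xz∙y a e b ⟩
    a + b + e       ≤⟨ +-monoʳ-≤ᴿ e h₁ ⟩
    c + d + e       ≈⟨ +-assoc c d e ⟩
    c + (d + e)     ≤⟨ +-monoˡ-≤ᴿ c h₂ ⟩
    c + (b + f)     ≈⟨ x∙yz≈xz∙y c b f ⟩
    c + f + b       ∎)

  ·ᴿ-distrib : ∀ m n a → (m ℕ.+ n) ·ᴿ a ≈ m ·ᴿ a + n ·ᴿ a
  ·ᴿ-distrib zero    n a = sym (+-identityˡ (n ·ᴿ a))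
  ·ᴿ-distrib (suc m) n a = trans (+-congˡ (·ᴿ-distrib m n a)) (sym (+-assoc a (m ·ᴿ a) (n ·ᴿ a)))

  ·ᴿ-nonneg : ∀ n {a} → 0# ≤ᴿ a → 0# ≤ᴿ n ·ᴿ a
  ·ᴿ-nonneg zero    0≤a = ≤ᴿ-refl
  ·ᴿ-nonneg (suc n) 0≤a = ≤ᴿ-trans 0≤a (x≤x+y _ (·ᴿ-nonneg n 0≤a))

  ·ᴿ-mono : ∀ {a m n} → 0# ≤ᴿ a → m ≤ n → m ·ᴿ a ≤ᴿ n ·ᴿ a
  ·ᴿ-mono {a} {m} {n} 0≤a m≤n = begin
    m ·ᴿ a                    ≤⟨ x≤x+y _ (·ᴿ-nonneg (n ∸ m) 0≤a) ⟩
    m ·ᴿ a + (n ∸ m) ·ᴿ a     ≈⟨ sym (·ᴿ-distrib m (n ∸ m) a) ⟩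
    (m ℕ.+ (n ∸ m)) ·ᴿ a      ≡⟨ cong (_·ᴿ a) (ℕₚ.m+[n∸m]≡n m≤n) ⟩
    n ·ᴿ a                    ∎

  minUpTo : ℕ → (ℕ → Carrier) → Carrier
  minUpTo zero    g = g 0
  minUpTo (suc n) g with total (minUpTo n g) (g (suc n))
  ... | inj₁ _ = minUpTo n g
  ... | inj₂ _ = g (suc n)

  minUpTo-lower : ∀ n g {y} → y ≤ n → minUpTo n g ≤ᴿ g y
  minUpTo-lower zero    g z≤n = ≤ᴿ-refl
  minUpTo-lower (suc n) g y≤1+n with total (minUpTo n g) (g (suc n)) | ℕₚ.m≤n⇒m<n∨m≡n y≤1+n
  ... | inj₁ _       | inj₁ (s≤s y≤n) = minUpTo-lower n g y≤n
  ... | inj₁ min≤new | inj₂ ≡.refl    = min≤new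
  ... | inj₂ new≤min | inj₁ (s≤s y≤n) = ≤ᴿ-trans new≤min (minUpTo-lower n g y≤n)
  ... | inj₂ _       | inj₂ ≡.refl    = ≤ᴿ-refl

  minUpTo-attained : ∀ n g → ∃[ y ] y ≤ n × g y ≤ᴿ minUpTo n g
  minUpTo-attained zero    g = 0 , z≤n , ≤ᴿ-refl
  minUpTo-attained (suc n) g with total (minUpTo n g) (g (suc n))
  ... | inj₂ _ = suc n , ℕₚ.≤-refl , ≤ᴿ-refl
  ... | inj₁ _ with minUpTo-attained n g
  ...   | y , y≤n , gy≤min = y , ℕₚ.m≤n⇒m≤1+n y≤n , gy≤min

  stepwise-mono : ∀ (g : ℕ → Carrier) {lo hi} →
    (∀ y → lo ≤ y → suc y ≤ hi → g y ≤ᴿ g (suc y)) →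
    ∀ {x y} → lo ≤ x → x ≤ y → y ≤ hi → g x ≤ᴿ g y
  stepwise-mono g step {y = zero}  _    z≤n   _      = ≤ᴿ-refl
  stepwise-mono g step {y = suc y} lo≤x x≤1+y 1+y≤hi with ℕₚ.m≤n⇒m<n∨m≡n x≤1+y
  ... | inj₂ ≡.refl    = ≤ᴿ-refl
  ... | inj₁ (s≤s x≤y) = ≤ᴿ-trans (stepwise-mono g step lo≤x x≤y (ℕₚ.<⇒≤ 1+y≤hi))
                                  (step y (ℕₚ.≤-trans lo≤x x≤y) 1+y≤hi)

  stepwise-slope : ∀ (g : ℕ → Carrier) a {hi} →
    (∀ z → suc z ≤ hi → g (suc z) ≤ᴿ g z + a) →
    ∀ {x y} → y ≤ x → x ≤ hi → g x ≤ᴿ g y + (x ∸ y) ·ᴿ a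
  stepwise-slope g a step {zero}  z≤n   _ = ≤ᴿ-reflexive (sym (+-identityʳ (g 0)))
  stepwise-slope g a {hi} step {suc x} {y} y≤1+x 1+x≤hi with ℕₚ.m≤n⇒m<n∨m≡n y≤1+x
  ... | inj₂ ≡.refl rewrite ℕₚ.n∸n≡0 x = ≤ᴿ-reflexive (sym (+-identityʳ (g (suc x))))
  ... | inj₁ (s≤s y≤x) = begin
    g (suc x)                       ≤⟨ step x 1+x≤hi ⟩
    g x + a                         ≤⟨ +-monoʳ-≤ᴿ a (stepwise-slope g a step y≤x x≤hi) ⟩
    g y + (x ∸ y) ·ᴿ a + a          ≈⟨ xy∙z≈x∙zy (g y) ((x ∸ y) ·ᴿ a) a ⟩
    g y + suc (x ∸ y) ·ᴿ a          ≡⟨ cong (λ d → g y + d ·ᴿ a) (ℕₚ.+-∸-assoc 1 y≤x) ⟨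
    g y + (suc x ∸ y) ·ᴿ a          ∎
    where
    x≤hi : x ≤ hi
    x≤hi = ℕₚ.<⇒≤ 1+x≤hi

module ScheduleLemmas {A : Set} where
  lastOr : ∀ {n} → A → Vec A n → A
  lastOr p []       = p
  lastOr p (x ∷ xs) = lastOr x xs

  last≡lastOr : ∀ {n} p (xs : Vec A (suc n)) → last xs ≡ lastOr p xs
  last≡lastOr p (x ∷ [])     = ≡.refl
  last≡lastOr p (x ∷ y ∷ xs) = last≡lastOr x (y ∷ xs)

  lastOr-∷ʳ : ∀ {n} p (xs : Vec A n) x → lastOr p (xs ∷ʳ x) ≡ x
  lastOr-∷ʳ p []       x = ≡.refl
  lastOr-∷ʳ p (y ∷ xs) x = lastOr-∷ʳ y xs x

  lastOr-zipWith : ∀ {n} (op : A → A → A) p q (xs ys : Vec A n) →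
    lastOr (op p q) (zipWith op xs ys) ≡ op (lastOr p xs) (lastOr q ys)
  lastOr-zipWith op p q []       []       = ≡.refl
  lastOr-zipWith op p q (x ∷ xs) (y ∷ ys) = lastOr-zipWith op x y xs ys

  module _ {P : A → Set} where
    All-lastOr : ∀ {n p} (xs : Vec A n) → P p → All P xs → P (lastOr p xs)
    All-lastOr []       Pp []         = Pp
    All-lastOr (x ∷ xs) Pp (Px ∷ Pxs) = All-lastOr xs Px Pxs

    All-∷ʳ⁺ : ∀ {n} (xs : Vec A n) {x} → All P xs → P x → All P (xs ∷ʳ x)
    All-∷ʳ⁺ []       []         Px = Px ∷ []
    All-∷ʳ⁺ (y ∷ xs) (Py ∷ Pxs) Px = Py ∷ All-∷ʳ⁺ xs Pxs Px

    All-∷ʳ⁻ : ∀ {n} (xs : Vec A n) {x} → All P (xs ∷ʳ x) → All P xs × P x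
    All-∷ʳ⁻ []       (Px ∷ [])  = [] , Px
    All-∷ʳ⁻ (y ∷ xs) (Py ∷ Pxs) = let Pxs′ , Px = All-∷ʳ⁻ xs Pxs in Py ∷ Pxs′ , Px

    All-zipWith : ∀ {n} (op : A → A → A) → (∀ {a b} → P a → P b → P (op a b)) →
      {xs ys : Vec A n} → All P xs → All P ys → All P (zipWith op xs ys)
    All-zipWith op P-op []         []         = []
    All-zipWith op P-op (Px ∷ Pxs) (Py ∷ Pys) = P-op Px Py ∷ All-zipWith op P-op Pxs Pys

open ScheduleLemmas

module Analysis {c ℓ₁ ℓ₂} (R : OrderedCommutativeRing c ℓ₁ ℓ₂) where
  open OrderedCommutativeRing R hiding (zero)
  open OrderedRingLemmas R
  open DataCenter R

  module CostIdentities (f : CostFns) (β : Carrier) where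
    open SetoidReasoning setoid
    open +-Solver using (_⊕_; _⊜_)

    costUp-∷ʳ : ∀ {n} t p (xs : Vec ℕ n) x →
      costUp f β t p (xs ∷ʳ x) ≈ costUp f β t p xs + (f (t ℕ.+ n) x + (x ∸ lastOr p xs) ·ᴿ β)
    costUp-∷ʳ t p [] x rewrite ℕₚ.+-identityʳ t = trans (+-identityʳ _) (sym (+-identityˡ _))
    costUp-∷ʳ {suc n} t p (y ∷ xs) x rewrite ℕₚ.+-suc t n =
      trans (+-congˡ (costUp-∷ʳ (suc t) y xs x)) (sym (+-assoc _ _ _))

    CL-∷ʳ : ∀ {k} (xs : Vec ℕ (suc k)) x →
      CL f β (xs ∷ʳ x) ≈ f (suc (suc k)) x + (CL f β xs + (x ∸ lastOr 0 xs) ·ᴿ β)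
    CL-∷ʳ xs x = trans (costUp-∷ʳ 1 0 xs x) (x∙yz≈y∙xz (CL f β xs) _ _)

    costUp-costDown : ∀ {n} t p (xs : Vec ℕ n) →
      costUp f β t p xs + p ·ᴿ β ≈ costDown f β t p xs + lastOr p xs ·ᴿ β
    costUp-costDown t p []       = refl
    costUp-costDown t p (x ∷ xs) = begin
      f t x + (x ∸ p) ·ᴿ β + up + p ·ᴿ β
        ≈⟨ +-Solver.solve 4 (λ F A U P → ((F ⊕ A) ⊕ U) ⊕ P ⊜ (F ⊕ (A ⊕ P)) ⊕ U) refl
             (f t x) ((x ∸ p) ·ᴿ β) up (p ·ᴿ β) ⟩
      f t x + ((x ∸ p) ·ᴿ β + p ·ᴿ β) + up
        ≈⟨ +-congʳ (+-congˡ moveUp≈moveDown) ⟩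
      f t x + ((p ∸ x) ·ᴿ β + x ·ᴿ β) + up
        ≈⟨ +-Solver.solve 4 (λ F B X U → (F ⊕ (B ⊕ X)) ⊕ U ⊜ (F ⊕ B) ⊕ (U ⊕ X)) refl
             (f t x) ((p ∸ x) ·ᴿ β) (x ·ᴿ β) up ⟩
      f t x + (p ∸ x) ·ᴿ β + (up + x ·ᴿ β)
        ≈⟨ +-congˡ (costUp-costDown (suc t) x xs) ⟩
      f t x + (p ∸ x) ·ᴿ β + (costDown f β (suc t) x xs + lastOr x xs ·ᴿ β)
        ≈⟨ sym (+-assoc _ _ _) ⟩
      f t x + (p ∸ x) ·ᴿ β + costDown f β (suc t) x xs + lastOr x xs ·ᴿ β ∎
      where
      up : Carrier
      up = costUp f β (suc t) x xs
      moveUp≈moveDown : (x ∸ p) ·ᴿ β + p ·ᴿ β ≈ (p ∸ x) ·ᴿ β + x ·ᴿ β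
      moveUp≈moveDown = trans (sym (·ᴿ-distrib (x ∸ p) p β))
        (trans (reflexive (cong (_·ᴿ β) (m∸n+n≡n∸m+m x p))) (·ᴿ-distrib (p ∸ x) x β))

    CL≈CU+last : ∀ {n} (xs : Vec ℕ n) → CL f β xs ≈ CU f β xs + lastOr 0 xs ·ᴿ β
    CL≈CU+last xs = trans (sym (+-identityʳ _)) (costUp-costDown 1 0 xs)

  -- The value function V k x: the least C^L-cost of a feasible schedule of
  -- length k+1 whose last state is x.
  module ValueFunction (m : ℕ) (β : Carrier) (f : CostFns) (β≥0 : 0# ≤ᴿ β) where
    open CostIdentities f β
    open ≤ᴿ-Reasoning

    V : ℕ → ℕ → Carrier
    V zero    x = f 1 x + x ·ᴿ β
    V (suc k) x = f (suc (suc k)) x + minUpTo m (λ y → V k y + (x ∸ y) ·ᴿ β)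

    V-lower : ∀ k (Y : Vec ℕ (suc k)) → Feasible m Y → V k (lastOr 0 Y) ≤ᴿ CL f β Y
    V-lower k Y Y-feasible with initLast Y
    V-lower zero    .([] ∷ʳ y) _          | [] , y , ≡.refl = ≤ᴿ-reflexive (sym (+-identityʳ _))
    V-lower (suc k) .(ys ∷ʳ y) Y-feasible | ys , y , ≡.refl rewrite lastOr-∷ʳ 0 ys y = begin
      f (suc (suc k)) y + minUpTo m (λ w → V k w + (y ∸ w) ·ᴿ β)
        ≤⟨ +-monoˡ-≤ᴿ _ (minUpTo-lower m _ z≤m) ⟩
      f (suc (suc k)) y + (V k z + (y ∸ z) ·ᴿ β)
        ≤⟨ +-monoˡ-≤ᴿ _ (+-monoʳ-≤ᴿ _ (V-lower k ys ys-feasible)) ⟩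
      f (suc (suc k)) y + (CL f β ys + (y ∸ z) ·ᴿ β)
        ≈⟨ sym (CL-∷ʳ ys y) ⟩
      CL f β (ys ∷ʳ y) ∎
      where
      ys-feasible : Feasible m ys
      ys-feasible = proj₁ (All-∷ʳ⁻ ys Y-feasible)
      z : ℕ
      z = lastOr 0 ys
      z≤m : z ≤ m
      z≤m = All-lastOr ys z≤n ys-feasible

    V-attained : ∀ k {x} → x ≤ m →
      Σ[ Z ∈ Vec ℕ (suc k) ] Feasible m Z × lastOr 0 Z ≡ x × CL f β Z ≤ᴿ V k x
    V-attained zero {x} x≤m = x ∷ [] , x≤m ∷ [] , ≡.refl , ≤ᴿ-reflexive (+-identityʳ _)
    V-attained (suc k) {x} x≤m with minUpTo-attained m (λ y → V k y + (x ∸ y) ·ᴿ β)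
    ... | y , y≤m , best≤min with V-attained k y≤m
    ...   | Z , Z-feasible , ≡.refl , CL-Z≤V =
      Z ∷ʳ x , All-∷ʳ⁺ Z Z-feasible x≤m , lastOr-∷ʳ 0 Z x , (begin
        CL f β (Z ∷ʳ x)
          ≈⟨ CL-∷ʳ Z x ⟩
        f (suc (suc k)) x + (CL f β Z + (x ∸ lastOr 0 Z) ·ᴿ β)
          ≤⟨ +-monoˡ-≤ᴿ _ (+-monoʳ-≤ᴿ _ CL-Z≤V) ⟩
        f (suc (suc k)) x + (V k (lastOr 0 Z) + (x ∸ lastOr 0 Z) ·ᴿ β)
          ≤⟨ +-monoˡ-≤ᴿ _ best≤min ⟩
        V (suc k) x ∎)

    V-step-lower : ∀ k → NonNeg m (f (suc (suc k))) →
      ∀ {z} → z ≤ m → ∃[ y ] y ≤ m × V k y + (z ∸ y) ·ᴿ β ≤ᴿ V (suc k) z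
    V-step-lower k f-nonneg {z} z≤m with minUpTo-attained m (λ y → V k y + (z ∸ y) ·ᴿ β)
    ... | y , y≤m , best≤min = y , y≤m , ≤ᴿ-trans best≤min (x≤y+x _ (f-nonneg z z≤m))

    module _ {φ : ℕ → Carrier} (φ-convex : Convex m φ) where
      convex-increments : ∀ {a b} → a ≤ b → suc b ≤ m → φ (suc a) + φ b ≤ᴿ φ a + φ (suc b)
      convex-increments {b = zero} z≤n _ = ≤ᴿ-reflexive (+-comm _ _)
      convex-increments {a} {suc b} a≤1+b 2+b≤m with ℕₚ.m≤n⇒m<n∨m≡n a≤1+b
      ... | inj₂ ≡.refl    = ≤ᴿ-reflexive (+-comm _ _)
      ... | inj₁ (s≤s a≤b) = diff-trans (convex-increments a≤b (ℕₚ.<⇒≤ 2+b≤m)) (φ-convex b 2+b≤m)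

      convex-squeeze : ∀ {a b} → b ≤ m → φ (squeeze₁ a b) + φ (squeeze₂ a b) ≤ᴿ φ a + φ b
      convex-squeeze {a} {b} b≤m with squeezeCase a b
      ... | ordered b≤a = subst₂ (λ u v → φ u + φ v ≤ᴿ φ a + φ b)
              (≡.sym (squeeze₁-ordered b≤a)) (≡.sym (squeeze₂-ordered b≤a)) ≤ᴿ-refl
      ... | crossed {b₀} a≤b₀ = subst₂ (λ u v → φ u + φ v ≤ᴿ φ a + φ (suc b₀))
              (≡.sym (squeeze₁-crossed a≤b₀)) (≡.sym (squeeze₂-crossed a≤b₀))
              (≤ᴿ-trans (≤ᴿ-reflexive (+-comm _ _)) (convex-increments a≤b₀ b≤m))

    squeeze-switching-β : ∀ a b p q →
      (squeeze₁ a b ∸ squeeze₁ p q) ·ᴿ β + (squeeze₂ a b ∸ squeeze₂ p q) ·ᴿ β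
        ≤ᴿ (a ∸ p) ·ᴿ β + (b ∸ q) ·ᴿ β
    squeeze-switching-β a b p q = begin
      (squeeze₁ a b ∸ squeeze₁ p q) ·ᴿ β + (squeeze₂ a b ∸ squeeze₂ p q) ·ᴿ β
        ≈⟨ sym (·ᴿ-distrib (squeeze₁ a b ∸ squeeze₁ p q) _ β) ⟩
      ((squeeze₁ a b ∸ squeeze₁ p q) ℕ.+ (squeeze₂ a b ∸ squeeze₂ p q)) ·ᴿ β
        ≤⟨ ·ᴿ-mono β≥0 (squeeze-switching a b p q) ⟩
      ((a ∸ p) ℕ.+ (b ∸ q)) ·ᴿ β
        ≈⟨ ·ᴿ-distrib (a ∸ p) (b ∸ q) β ⟩
      (a ∸ p) ·ᴿ β + (b ∸ q) ·ᴿ β ∎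

    squeeze-cost : ∀ {n} t p q (A B : Vec ℕ n) → Feasible m B →
      (∀ s → t ≤ s → s < t ℕ.+ n → Convex m (f s)) →
      costUp f β t (squeeze₁ p q) (zipWith squeeze₁ A B)
        + costUp f β t (squeeze₂ p q) (zipWith squeeze₂ A B)
        ≤ᴿ costUp f β t p A + costUp f β t q B
    squeeze-cost t p q []      []      _                  _      = ≤ᴿ-refl
    squeeze-cost {suc n} t p q (a ∷ A) (b ∷ B) (b≤m ∷ B-feasible) convex =
      ≤ᴿ-trans (≤ᴿ-reflexive (+-interchange₃ _ _ _ _ _ _))
        (≤ᴿ-trans (+-mono-≤ᴿ (convex-squeeze (convex t ℕₚ.≤-refl t<end) b≤m)
                            (+-mono-≤ᴿ (squeeze-switching-β a b p q)
                                       (squeeze-cost (suc t) a b A B B-feasible convex-later)))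
          (≤ᴿ-reflexive (sym (+-interchange₃ _ _ _ _ _ _))))
      where
      t<end : t < t ℕ.+ suc n
      t<end = ℕₚ.m<m+n t (s≤s z≤n)
      convex-later : ∀ s → suc t ≤ s → s < suc t ℕ.+ n → Convex m (f s)
      convex-later s t<s s<end =
        convex s (ℕₚ.<⇒≤ t<s) (subst (s <_) (≡.sym (ℕₚ.+-suc t n)) s<end)

    -- V k is convex as soon as f_1, …, f_{k+1} are: squeeze an optimal
    -- schedule ending in a with one ending in b+1.
    V-convex : ∀ k → (∀ t → 1 ≤ t → t ≤ suc k → Convex m (f t)) →
      ∀ {a b} → a ≤ b → suc b ≤ m → V k b + V k (suc a) ≤ᴿ V k a + V k (suc b)
    V-convex k convex {a} {b} a≤b 1+b≤m
      with V-attained k (ℕₚ.≤-trans (ℕₚ.m≤n⇒m≤1+n a≤b) 1+b≤m) | V-attained k 1+b≤m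
    ... | A , A-feasible , A-ends , CL-A≤ | B , B-feasible , B-ends , CL-B≤ = begin
      V k b + V k (suc a)                   ≡⟨ cong₂ (λ u v → V k u + V k v) G-ends H-ends ⟨
      V k (lastOr 0 G) + V k (lastOr 0 H)   ≤⟨ +-mono-≤ᴿ (V-lower k G G-feasible) (V-lower k H H-feasible) ⟩
      CL f β G + CL f β H                   ≤⟨ squeeze-cost 1 0 0 A B B-feasible convex′ ⟩
      CL f β A + CL f β B                   ≤⟨ +-mono-≤ᴿ CL-A≤ CL-B≤ ⟩
      V k a + V k (suc b)                   ∎
      where
      G H : Vec ℕ (suc k)
      G = zipWith squeeze₁ A B
      H = zipWith squeeze₂ A B
      G-feasible : Feasible m G
      G-feasible = All-zipWith squeeze₁ squeeze₁-bounded A-feasible B-feasible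
      H-feasible : Feasible m H
      H-feasible = All-zipWith squeeze₂ squeeze₂-bounded A-feasible B-feasible
      G-ends : lastOr 0 G ≡ b
      G-ends = ≡.trans (lastOr-zipWith squeeze₁ 0 0 A B)
                       (≡.trans (cong₂ squeeze₁ A-ends B-ends) (squeeze₁-crossed a≤b))
      H-ends : lastOr 0 H ≡ suc a
      H-ends = ≡.trans (lastOr-zipWith squeeze₂ 0 0 A B)
                       (≡.trans (cong₂ squeeze₂ A-ends B-ends) (squeeze₂-crossed a≤b))
      convex′ : ∀ s → 1 ≤ s → s < 1 ℕ.+ suc k → Convex m (f s)
      convex′ s 1≤s (s≤s s≤k+1) = convex s 1≤s s≤k+1

    module Thresholds (k L U : ℕ) (isL : IsXL f β m k L) (isU : IsXU f β m k U)
        (convex : ∀ t → 1 ≤ t → t ≤ suc k → Convex m (f t)) where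

      XL XU : Vec ℕ (suc k)
      XL = proj₁ (proj₁ isL)
      XU = proj₁ (proj₁ isU)

      XL-optimal : IsMinimizer (CL f β) m XL
      XL-optimal = proj₁ (proj₂ (proj₁ isL))

      XU-optimal : IsMinimizer (CU f β) m XU
      XU-optimal = proj₁ (proj₂ (proj₁ isU))

      XL-ends : lastOr 0 XL ≡ L
      XL-ends = ≡.trans (≡.sym (last≡lastOr 0 XL)) (proj₂ (proj₂ (proj₁ isL)))

      XU-ends : lastOr 0 XU ≡ U
      XU-ends = ≡.trans (≡.sym (last≡lastOr 0 XU)) (proj₂ (proj₂ (proj₁ isU)))

      L≤m : L ≤ m
      L≤m = subst (_≤ m) XL-ends (All-lastOr XL z≤n (proj₁ XL-optimal))

      U≤m : U ≤ m
      U≤m = subst (_≤ m) XU-ends (All-lastOr XU z≤n (proj₁ XU-optimal))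

      V-min-at-L : ∀ {x} → x ≤ m → V k L ≤ᴿ V k x
      V-min-at-L {x} x≤m with V-attained k x≤m
      ... | Z , Z-feasible , _ , CL-Z≤ = begin
        V k L               ≡⟨ cong (V k) (≡.sym XL-ends) ⟩
        V k (lastOr 0 XL)   ≤⟨ V-lower k XL (proj₁ XL-optimal) ⟩
        CL f β XL           ≤⟨ proj₂ XL-optimal Z Z-feasible ⟩
        CL f β Z            ≤⟨ CL-Z≤ ⟩
        V k x               ∎

      -- ... and V k x > V k L below L, since L is the least optimal last state.
      V-below-L : ∀ {x} → x < L → ¬ (V k x ≤ᴿ V k L)
      V-below-L {x} x<L Vx≤VL with V-attained k (ℕₚ.≤-trans (ℕₚ.<⇒≤ x<L) L≤m)
      ... | Z , Z-feasible , Z-ends , CL-Z≤ =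
        ℕₚ.<⇒≱ x<L (subst (L ≤_) Z-last (proj₂ isL Z (Z-feasible , Z-optimal)))
        where
        Z-last : last Z ≡ x
        Z-last = ≡.trans (last≡lastOr 0 Z) Z-ends
        Z-optimal : ∀ Y → Feasible m Y → CL f β Z ≤ᴿ CL f β Y
        Z-optimal Y Y-feasible = begin
          CL f β Z           ≤⟨ CL-Z≤ ⟩
          V k x              ≤⟨ Vx≤VL ⟩
          V k L              ≤⟨ V-min-at-L (All-lastOr Y z≤n Y-feasible) ⟩
          V k (lastOr 0 Y)   ≤⟨ V-lower k Y Y-feasible ⟩
          CL f β Y           ∎

      -- U minimises V k x − x·β, because C^L = C^U + (last state)·β.
      U-balance : ∀ {x} → x ≤ m → V k U + x ·ᴿ β ≤ᴿ V k x + U ·ᴿ β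
      U-balance {x} x≤m with V-attained k x≤m
      ... | Z , Z-feasible , Z-ends , CL-Z≤ = begin
        V k U + x ·ᴿ β                          ≡⟨ cong (λ u → V k u + x ·ᴿ β) (≡.sym XU-ends) ⟩
        V k (lastOr 0 XU) + x ·ᴿ β              ≤⟨ +-monoʳ-≤ᴿ _ (V-lower k XU (proj₁ XU-optimal)) ⟩
        CL f β XU + x ·ᴿ β                      ≈⟨ +-congʳ (CL≈CU+last XU) ⟩
        CU f β XU + lastOr 0 XU ·ᴿ β + x ·ᴿ β   ≈⟨ xy∙z≈xz∙y _ _ _ ⟩
        CU f β XU + x ·ᴿ β + lastOr 0 XU ·ᴿ β   ≤⟨ +-monoʳ-≤ᴿ _ (+-monoʳ-≤ᴿ _ XU≤Z) ⟩
        CU f β Z + x ·ᴿ β + lastOr 0 XU ·ᴿ β    ≡⟨ cong₂ (λ u v → CU f β Z + u ·ᴿ β + v ·ᴿ β)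
                                                         (≡.sym Z-ends) XU-ends ⟩
        CU f β Z + lastOr 0 Z ·ᴿ β + U ·ᴿ β     ≈⟨ +-congʳ (sym (CL≈CU+last Z)) ⟩
        CL f β Z + U ·ᴿ β                       ≤⟨ +-monoʳ-≤ᴿ _ CL-Z≤ ⟩
        V k x + U ·ᴿ β                          ∎
        where
        XU≤Z : CU f β XU ≤ᴿ CU f β Z
        XU≤Z = proj₂ XU-optimal Z Z-feasible

      L≤U : L ≤ U
      L≤U with ℕₚ.≤-total L U
      ... | inj₁ L≤U = L≤U
      ... | inj₂ U≤L with ℕₚ.m≤n⇒m<n∨m≡n U≤L
      ...   | inj₂ U≡L = ℕₚ.≤-reflexive (≡.sym U≡L)
      ...   | inj₁ U<L = ⊥-elim (V-below-L U<L (+-cancelʳ-≤ᴿ (U ·ᴿ β)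
                (≤ᴿ-trans (+-monoˡ-≤ᴿ (V k U) (·ᴿ-mono β≥0 U≤L)) (U-balance L≤m))))

      -- Convexity of V k turns the two extremal properties into slope bounds:
      -- V k is nondecreasing on [L, m] ...
      V-mono-above-L : ∀ {x y} → L ≤ x → x ≤ y → y ≤ m → V k x ≤ᴿ V k y
      V-mono-above-L = stepwise-mono (V k) step
        where
        step : ∀ y → L ≤ y → suc y ≤ m → V k y ≤ᴿ V k (suc y)
        step y L≤y 1+y≤m = +-cancelʳ-≤ᴿ (V k (suc L)) (begin
          V k y + V k (suc L)        ≤⟨ V-convex k convex L≤y 1+y≤m ⟩
          V k L + V k (suc y)        ≤⟨ +-monoʳ-≤ᴿ _ (V-min-at-L 1+L≤m) ⟩
          V k (suc L) + V k (suc y)  ≈⟨ +-comm _ _ ⟩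
          V k (suc y) + V k (suc L)  ∎)
          where
          1+L≤m : suc L ≤ m
          1+L≤m = ℕₚ.≤-trans (s≤s L≤y) 1+y≤m

      -- ... and grows by at most β per unit on [0, U].
      V-slope-below-U : ∀ {x y} → y ≤ x → x ≤ U → V k x ≤ᴿ V k y + (x ∸ y) ·ᴿ β
      V-slope-below-U = stepwise-slope (V k) β step
        where
        -- by U-balance, V k rises by at most β on the last unit below U
        last-step : ∀ {b} → U ≡ suc b → V k (suc b) ≤ᴿ V k b + β
        last-step {b} U≡1+b = +-cancelʳ-≤ᴿ (b ·ᴿ β) (begin
          V k (suc b) + b ·ᴿ β      ≤⟨ subst (λ u → V k u + b ·ᴿ β ≤ᴿ V k b + u ·ᴿ β) U≡1+b
                                             (U-balance (ℕₚ.≤-trans (ℕₚ.n≤1+n b) 1+b≤m)) ⟩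
          V k b + (β + b ·ᴿ β)      ≈⟨ sym (+-assoc _ _ _) ⟩
          V k b + β + b ·ᴿ β        ∎)
          where
          1+b≤m : suc b ≤ m
          1+b≤m = subst (_≤ m) U≡1+b U≤m
        -- and by convexity, no unit step below U rises by more
        step : ∀ z → suc z ≤ U → V k (suc z) ≤ᴿ V k z + β
        step z 1+z≤U with U-predecessor 1+z≤U
          where
          U-predecessor : ∀ {n} → suc z ≤ n → ∃[ b ] n ≡ suc b × z ≤ b
          U-predecessor (s≤s z≤b) = _ , ≡.refl , z≤b
        ... | b , U≡1+b , z≤b = +-cancelˡ-≤ᴿ (V k b) (begin
          V k b + V k (suc z)       ≤⟨ V-convex k convex z≤b (subst (_≤ m) U≡1+b U≤m) ⟩
          V k z + V k (suc b)       ≤⟨ +-monoˡ-≤ᴿ (V k z) (last-step U≡1+b) ⟩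
          V k z + (V k b + β)       ≈⟨ x∙yz≈y∙xz _ _ _ ⟩
          V k b + (V k z + β)       ∎)

      V-reachable : ∀ {x y} → L ≤ x → x ≤ U → y ≤ m → V k x ≤ᴿ V k y + (x ∸ y) ·ᴿ β
      V-reachable {x} {y} L≤x x≤U y≤m with ℕₚ.≤-total x y
      ... | inj₂ y≤x = V-slope-below-U y≤x x≤U
      ... | inj₁ x≤y = begin
        V k x                   ≤⟨ V-mono-above-L L≤x x≤y y≤m ⟩
        V k y                   ≈⟨ sym (+-identityʳ _) ⟩
        V k y + 0 ·ᴿ β          ≡⟨ cong (λ d → V k y + d ·ᴿ β) (ℕₚ.m≤n⇒m∸n≡0 x≤y) ⟨
        V k y + (x ∸ y) ·ᴿ β    ∎

  module LCP (T m : ℕ) (β : Carrier) (f : CostFns) (β≥0 : 0# ≤ᴿ β)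
      (nonneg : ∀ t → 1 ≤ t → t ≤ T → NonNeg m (f t))
      (convex : ∀ t → 1 ≤ t → t ≤ T → Convex m (f t))
      (xL xU : ℕ → ℕ)
      (isL : ∀ k → suc k ≤ T → IsXL f β m k (xL (suc k)))
      (isU : ∀ k → suc k ≤ T → IsXU f β m k (xU (suc k))) where
    open ValueFunction m β f β≥0
    open ≤ᴿ-Reasoning

    module Step (k : ℕ) (k<T : suc k ≤ T) =
      Thresholds k (xL (suc k)) (xU (suc k)) (isL k k<T) (isU k k<T)
        (λ t 1≤t t≤k+1 → convex t 1≤t (ℕₚ.≤-trans t≤k+1 k<T))

    x : ℕ → ℕ
    x = lcp xL xU

    lcpCost : ℕ → Carrier
    lcpCost zero    = 0#
    lcpCost (suc τ) = lcpCost τ + (f (suc τ) (x (suc τ)) + (x (suc τ) ∸ x τ) ·ᴿ β)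

    powerUp : ℕ → ℕ
    powerUp zero    = 0
    powerUp (suc τ) = powerUp τ ℕ.+ (x (suc τ) ∸ x τ)

    -- The invariant after step k+1, for a state a reached with total
    -- power-up u at cost S.
    record Invariant (k a u : ℕ) (S : Carrier) : Set ℓ₂ where
      field
        L≤a          : xL (suc k) ≤ a
        a≤U          : a ≤ xU (suc k)
        powerUp≤V-L  : u ·ᴿ β ≤ᴿ V k (xL (suc k))
        powerUp-vs-U : u ·ᴿ β + xU (suc k) ·ᴿ β ≤ᴿ V k (xU (suc k)) + a ·ᴿ β
        cost-bound   : S + a ·ᴿ β ≤ᴿ V k a + (u ·ᴿ β + u ·ᴿ β)

    -- since f_{k+2} ≥ 0, V (k+1) never drops below the minimum of V k
    V-min≤V-next : ∀ k → suc (suc k) ≤ T → ∀ {z} → z ≤ m → V k (xL (suc k)) ≤ᴿ V (suc k) z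
    V-min≤V-next k k+2≤T {z} z≤m with V-step-lower k (nonneg (suc (suc k)) (s≤s z≤n) k+2≤T) z≤m
    ... | y , y≤m , step≤ = begin
      V k (xL (suc k))        ≤⟨ Step.V-min-at-L k (ℕₚ.<⇒≤ k+2≤T) y≤m ⟩
      V k y                   ≤⟨ x≤x+y _ (·ᴿ-nonneg (z ∸ y) β≥0) ⟩
      V k y + (z ∸ y) ·ᴿ β    ≤⟨ step≤ ⟩
      V (suc k) z             ∎

    invariant-first : 1 ≤ T → Invariant 0 (x 1) (powerUp 1) (lcpCost 1)
    invariant-first 1≤T = subst (λ a → Invariant 0 a a (0# + (f 1 a + a ·ᴿ β))) (≡.sym x₁≡L) (record
      { L≤a          = ℕₚ.≤-refl
      ; a≤U          = K.L≤U
      ; powerUp≤V-L  = x≤y+x _ (f₁-nonneg K.L≤m)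
      ; powerUp-vs-U = ≤ᴿ-trans (≤ᴿ-reflexive (+-comm _ _))
                                (+-monoʳ-≤ᴿ _ (x≤y+x _ (f₁-nonneg K.U≤m)))
      ; cost-bound   = ≤ᴿ-trans (≤ᴿ-reflexive (+-congʳ (+-identityˡ _)))
                                (+-monoˡ-≤ᴿ _ (x≤x+y _ (·ᴿ-nonneg L β≥0)))
      })
      where
      module K = Step 0 1≤T
      L : ℕ
      L = xL 1
      x₁≡L : x 1 ≡ L
      x₁≡L = ≡.trans (cong (L ⊔_) (ℕₚ.⊓-zeroʳ (xU 1))) (ℕₚ.⊔-identityʳ L)
      f₁-nonneg : ∀ {z} → z ≤ m → 0# ≤ᴿ f 1 z
      f₁-nonneg {z} = nonneg 1 ℕₚ.≤-refl 1≤T z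

    module NextStep (k : ℕ) (k+2≤T : suc (suc k) ≤ T) {a u : ℕ} {S : Carrier}
        (inv : Invariant k a u S) where
      open Invariant inv
      module K  = Step k (ℕₚ.<⇒≤ k+2≤T)
      module K′ = Step (suc k) k+2≤T

      L′ U′ a′ D : ℕ
      L′ = xL (suc (suc k))
      U′ = xU (suc (suc k))
      a′ = L′ ⊔ (U′ ⊓ a)
      D  = a′ ∸ a

      charge : ∀ {z} → z ≤ m → u ·ᴿ β + z ·ᴿ β ≤ᴿ V (suc k) z + a ·ᴿ β
      charge {z} z≤m with V-step-lower k (nonneg (suc (suc k)) (s≤s z≤n) k+2≤T) z≤m
      ... | y , y≤m , step≤ = begin
        u ·ᴿ β + z ·ᴿ β                    ≤⟨ +-monoˡ-≤ᴿ _ z-split ⟩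
        u ·ᴿ β + ((z ∸ y) ·ᴿ β + y ·ᴿ β)   ≈⟨ x∙yz≈xz∙y _ _ _ ⟩
        u ·ᴿ β + y ·ᴿ β + (z ∸ y) ·ᴿ β     ≤⟨ +-monoʳ-≤ᴿ _ paid-to-y ⟩
        a ·ᴿ β + V k y + (z ∸ y) ·ᴿ β      ≈⟨ +-assoc _ _ _ ⟩
        a ·ᴿ β + (V k y + (z ∸ y) ·ᴿ β)    ≤⟨ +-monoˡ-≤ᴿ _ step≤ ⟩
        a ·ᴿ β + V (suc k) z               ≈⟨ +-comm _ _ ⟩
        V (suc k) z + a ·ᴿ β               ∎
        where
        z-split : z ·ᴿ β ≤ᴿ (z ∸ y) ·ᴿ β + y ·ᴿ β
        z-split = ≤ᴿ-trans (·ᴿ-mono β≥0 (subst (z ≤_) (ℕₚ.+-comm y (z ∸ y)) (ℕₚ.m≤n+m∸n z y)))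
                           (≤ᴿ-reflexive (·ᴿ-distrib (z ∸ y) y β))
        paid-to-y : u ·ᴿ β + y ·ᴿ β ≤ᴿ a ·ᴿ β + V k y
        paid-to-y = diff-trans (≤ᴿ-trans powerUp-vs-U (≤ᴿ-reflexive (+-comm _ _)))
                               (≤ᴿ-trans (K.U-balance y≤m) (≤ᴿ-reflexive (+-comm _ _)))

      charge′ : ∀ {z} → z ≤ m → (u ℕ.+ D) ·ᴿ β + z ·ᴿ β ≤ᴿ V (suc k) z + (a ℕ.+ D) ·ᴿ β
      charge′ {z} z≤m = begin
        (u ℕ.+ D) ·ᴿ β + z ·ᴿ β           ≈⟨ +-congʳ (·ᴿ-distrib u D β) ⟩
        u ·ᴿ β + D ·ᴿ β + z ·ᴿ β          ≈⟨ xy∙z≈xz∙y _ _ _ ⟩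
        u ·ᴿ β + z ·ᴿ β + D ·ᴿ β          ≤⟨ +-monoʳ-≤ᴿ _ (charge z≤m) ⟩
        V (suc k) z + a ·ᴿ β + D ·ᴿ β     ≈⟨ +-assoc _ _ _ ⟩
        V (suc k) z + (a ·ᴿ β + D ·ᴿ β)   ≈⟨ +-congˡ (sym (·ᴿ-distrib a D β)) ⟩
        V (suc k) z + (a ℕ.+ D) ·ᴿ β      ∎

      no-power-up : a′ ≤ a → u ℕ.+ D ≡ u
      no-power-up a′≤a = ≡.trans (cong (u ℕ.+_) (ℕₚ.m≤n⇒m∸n≡0 a′≤a)) (ℕₚ.+-identityʳ u)

      powerUp≤V-L′ : (u ℕ.+ D) ·ᴿ β ≤ᴿ V (suc k) L′
      powerUp≤V-L′ with a′ ℕ.≤? a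
      ... | yes a′≤a = begin
        (u ℕ.+ D) ·ᴿ β     ≡⟨ cong (_·ᴿ β) (no-power-up a′≤a) ⟩
        u ·ᴿ β             ≤⟨ powerUp≤V-L ⟩
        V k (xL (suc k))   ≤⟨ V-min≤V-next k k+2≤T K′.L≤m ⟩
        V (suc k) L′       ∎
      ... | no a′≰a = +-cancelʳ-≤ᴿ (L′ ·ᴿ β) (begin
        (u ℕ.+ D) ·ᴿ β + L′ ·ᴿ β        ≤⟨ charge′ K′.L≤m ⟩
        V (suc k) L′ + (a ℕ.+ D) ·ᴿ β   ≡⟨ cong (λ w → V (suc k) L′ + w ·ᴿ β) a+D≡L′ ⟩
        V (suc k) L′ + L′ ·ᴿ β          ∎)
        where
        a<a′ : a < a′
        a<a′ = ℕₚ.≰⇒> a′≰a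
        a+D≡L′ : a ℕ.+ D ≡ L′
        a+D≡L′ = ≡.trans (ℕₚ.m+[n∸m]≡n (ℕₚ.<⇒≤ a<a′)) (lcp-up-lands-on-L a<a′)

      powerUp-vs-U′ : (u ℕ.+ D) ·ᴿ β + U′ ·ᴿ β ≤ᴿ V (suc k) U′ + a′ ·ᴿ β
      powerUp-vs-U′ with a ℕ.≤? a′
      ... | yes a≤a′ = let a+D≡a′ = ℕₚ.m+[n∸m]≡n a≤a′ in begin
        (u ℕ.+ D) ·ᴿ β + U′ ·ᴿ β        ≤⟨ charge′ K′.U≤m ⟩
        V (suc k) U′ + (a ℕ.+ D) ·ᴿ β   ≡⟨ cong (λ w → V (suc k) U′ + w ·ᴿ β) a+D≡a′ ⟩
        V (suc k) U′ + a′ ·ᴿ β          ∎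
      ... | no a≰a′ = begin
        (u ℕ.+ D) ·ᴿ β + U′ ·ᴿ β        ≡⟨ cong (λ w → w ·ᴿ β + U′ ·ᴿ β) (no-power-up (ℕₚ.<⇒≤ a′<a)) ⟩
        u ·ᴿ β + U′ ·ᴿ β                ≤⟨ +-monoʳ-≤ᴿ _ (≤ᴿ-trans powerUp≤V-L V-L≤V-U′) ⟩
        V (suc k) U′ + U′ ·ᴿ β          ≡⟨ cong (λ w → V (suc k) U′ + w ·ᴿ β) a′≡U′ ⟨
        V (suc k) U′ + a′ ·ᴿ β          ∎
        where
        a′<a : a′ < a
        a′<a = ℕₚ.≰⇒> a≰a′
        a′≡U′ : a′ ≡ U′
        a′≡U′ = lcp-down-lands-on-U K′.L≤U a′<a
        V-L≤V-U′ : V k (xL (suc k)) ≤ᴿ V (suc k) U′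
        V-L≤V-U′ = V-min≤V-next k k+2≤T K′.U≤m

      cost-via : ∀ {y} → y ≤ m → S + a ·ᴿ β ≤ᴿ V k y + (a ∸ y) ·ᴿ β + (u ·ᴿ β + u ·ᴿ β)
      cost-via y≤m = ≤ᴿ-trans cost-bound (+-monoʳ-≤ᴿ _ (K.V-reachable L≤a a≤U y≤m))

      detour-β : ∀ y → (a ∸ y) ·ᴿ β + a′ ·ᴿ β ≤ᴿ (a′ ∸ y) ·ᴿ β + (D ·ᴿ β + a ·ᴿ β)
      detour-β y = begin
        (a ∸ y) ·ᴿ β + a′ ·ᴿ β            ≈⟨ sym (·ᴿ-distrib (a ∸ y) a′ β) ⟩
        ((a ∸ y) ℕ.+ a′) ·ᴿ β             ≤⟨ ·ᴿ-mono β≥0 (∸-detour a y a′) ⟩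
        ((a′ ∸ y) ℕ.+ (D ℕ.+ a)) ·ᴿ β     ≈⟨ ·ᴿ-distrib (a′ ∸ y) (D ℕ.+ a) β ⟩
        (a′ ∸ y) ·ᴿ β + (D ℕ.+ a) ·ᴿ β    ≈⟨ +-congˡ (·ᴿ-distrib D a β) ⟩
        (a′ ∸ y) ·ᴿ β + (D ·ᴿ β + a ·ᴿ β) ∎

      -- The new cost S + f(a′) + D·β, routed through the optimal
      -- predecessor y of a′ in V (k+1) a′.
      cost-bound′ : S + (f (suc (suc k)) a′ + D ·ᴿ β) + a′ ·ᴿ β
                      ≤ᴿ V (suc k) a′ + ((u ℕ.+ D) ·ᴿ β + (u ℕ.+ D) ·ᴿ β)
      cost-bound′ with minUpTo-attained m (λ y → V k y + (a′ ∸ y) ·ᴿ β)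
      ... | y , y≤m , best≤min = +-cancelʳ-≤ᴿ aβ (begin
        S + (F + Dβ) + a′β + aβ             ≈⟨ +-Solver.solve 5 (λ S F D A′ A →
                                                 ((S ⊕ (F ⊕ D)) ⊕ A′) ⊕ A ⊜ (S ⊕ A) ⊕ ((F ⊕ D) ⊕ A′))
                                                 refl S F Dβ a′β aβ ⟩
        (S + aβ) + (F + Dβ + a′β)           ≤⟨ +-monoʳ-≤ᴿ _ (cost-via y≤m) ⟩
        (V k y + ayβ + 2u) + (F + Dβ + a′β) ≈⟨ +-Solver.solve 6 (λ Vy AY U F D A′ →
                                                 ((Vy ⊕ AY) ⊕ U) ⊕ ((F ⊕ D) ⊕ A′)
                                                   ⊜ ((Vy ⊕ U) ⊕ (F ⊕ D)) ⊕ (AY ⊕ A′))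
                                                 refl (V k y) ayβ 2u F Dβ a′β ⟩
        P + (ayβ + a′β)                     ≤⟨ +-monoˡ-≤ᴿ P (detour-β y) ⟩
        P + (a′yβ + (Dβ + aβ))              ≈⟨ +-Solver.solve 6 (λ Vy u F D A′Y A →
                                                 ((Vy ⊕ (u ⊕ u)) ⊕ (F ⊕ D)) ⊕ (A′Y ⊕ (D ⊕ A))
                                                   ⊜ ((F ⊕ (Vy ⊕ A′Y)) ⊕ ((u ⊕ D) ⊕ (u ⊕ D))) ⊕ A)
                                                 refl (V k y) (u ·ᴿ β) F Dβ a′yβ aβ ⟩
        F + (V k y + a′yβ) + 2u′ + aβ       ≤⟨ +-monoʳ-≤ᴿ _ (+-monoʳ-≤ᴿ _ (+-monoˡ-≤ᴿ F best≤min)) ⟩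
        V (suc k) a′ + 2u′ + aβ             ≈⟨ +-congʳ (+-congˡ (sym (+-cong (·ᴿ-distrib u D β)
                                                                         (·ᴿ-distrib u D β)))) ⟩
        V (suc k) a′ + ((u ℕ.+ D) ·ᴿ β + (u ℕ.+ D) ·ᴿ β) + aβ ∎)
        where
        open +-Solver using (_⊕_; _⊜_)
        F Dβ aβ a′β ayβ a′yβ 2u 2u′ P : Carrier
        F    = f (suc (suc k)) a′
        Dβ   = D ·ᴿ β
        aβ   = a ·ᴿ β
        a′β  = a′ ·ᴿ β
        ayβ  = (a ∸ y) ·ᴿ β
        a′yβ = (a′ ∸ y) ·ᴿ β
        2u   = u ·ᴿ β + u ·ᴿ β
        2u′  = (u ·ᴿ β + Dβ) + (u ·ᴿ β + Dβ)
        P    = V k y + 2u + (F + Dβ)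

      next : Invariant (suc k) a′ (u ℕ.+ D) (S + (f (suc (suc k)) a′ + D ·ᴿ β))
      next = record
        { L≤a          = ℕₚ.m≤m⊔n L′ (U′ ⊓ a)
        ; a≤U          = ℕₚ.⊔-lub K′.L≤U (ℕₚ.m⊓n≤m U′ a)
        ; powerUp≤V-L  = powerUp≤V-L′
        ; powerUp-vs-U = powerUp-vs-U′
        ; cost-bound   = cost-bound′
        }

    invariant : ∀ k → suc k ≤ T → Invariant k (x (suc k)) (powerUp (suc k)) (lcpCost (suc k))
    invariant zero    1≤T   = invariant-first 1≤T
    invariant (suc k) k+2≤T = NextStep.next k k+2≤T (invariant k (ℕₚ.<⇒≤ k+2≤T))

    -- The invariant bounds the cost by three times that of any feasible
    -- schedule of the same length: S ≤ V(L) + 2u·β ≤ 3·V(L).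
    invariant⇒bound : ∀ k → suc k ≤ T → ∀ {a u S} → Invariant k a u S →
      (Y : Vec ℕ (suc k)) → Feasible m Y → S ≤ᴿ 3 ·ᴿ CL f β Y
    invariant⇒bound k k<T {a} {u} {S} inv Y Y-feasible = +-cancelʳ-≤ᴿ (a ·ᴿ β) (begin
      S + a ·ᴿ β                                  ≤⟨ cost-bound ⟩
      V k a + (u ·ᴿ β + u ·ᴿ β)                   ≤⟨ +-monoʳ-≤ᴿ _ (K.V-slope-below-U L≤a a≤U) ⟩
      V k L + (a ∸ L) ·ᴿ β + (u ·ᴿ β + u ·ᴿ β)    ≤⟨ +-mono-≤ᴿ (+-mono-≤ᴿ VL≤O (·ᴿ-mono β≥0 (ℕₚ.m∸n≤m a L)))
                                                               (+-mono-≤ᴿ u≤O u≤O) ⟩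
      O + a ·ᴿ β + (O + O)                        ≈⟨ +-Solver.solve 2 (λ O A →
                                                       (O ⊕ A) ⊕ (O ⊕ O) ⊜ (O ⊕ (O ⊕ (O ⊕ id))) ⊕ A)
                                                       refl O (a ·ᴿ β) ⟩
      3 ·ᴿ O + a ·ᴿ β                             ∎)
      where
      open Invariant inv
      open +-Solver using (_⊕_; _⊜_; id)
      module K = Step k k<T
      L : ℕ
      L = xL (suc k)
      O : Carrier
      O = CL f β Y
      VL≤O : V k L ≤ᴿ O
      VL≤O = ≤ᴿ-trans (K.V-min-at-L (All-lastOr Y z≤n Y-feasible)) (V-lower k Y Y-feasible)
      u≤O : u ·ᴿ β ≤ᴿ O
      u≤O = ≤ᴿ-trans powerUp≤V-L VL≤O

    lcpFrom : ℕ → (n : ℕ) → Vec ℕ n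
    lcpFrom s zero    = []
    lcpFrom s (suc n) = x (suc s) ∷ lcpFrom (suc s) n

    lcpFrom≡tabulate : ∀ n s → lcpFrom s n ≡ tabulate (λ i → x (suc (s ℕ.+ toℕ i)))
    lcpFrom≡tabulate zero    s = ≡.refl
    lcpFrom≡tabulate (suc n) s = cong₂ _∷_ (cong (λ j → x (suc j)) (≡.sym (ℕₚ.+-identityʳ s)))
      (≡.trans (lcpFrom≡tabulate n (suc s))
               (tabulate-cong (λ i → cong (λ j → x (suc j)) (≡.sym (ℕₚ.+-suc s (toℕ i))))))

    lcpCost-split : ∀ n s → lcpCost s + costUp f β (suc s) (x s) (lcpFrom s n) ≈ lcpCost (s ℕ.+ n)
    lcpCost-split zero    s rewrite ℕₚ.+-identityʳ s = +-identityʳ (lcpCost s)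
    lcpCost-split (suc n) s rewrite ℕₚ.+-suc s n = trans (sym (+-assoc _ _ _)) (lcpCost-split n (suc s))

    lcp-3-competitive : ∀ k → suc k ≤ T → (Y : Vec ℕ (suc k)) → Feasible m Y →
      CL f β (lcpSchedule xL xU (suc k)) ≤ᴿ 3 ·ᴿ CL f β Y
    lcp-3-competitive k k<T Y Y-feasible = begin
      CL f β (lcpSchedule xL xU (suc k))   ≡⟨ cong (λ X → CL f β X) (lcpFrom≡tabulate (suc k) 0) ⟨
      CL f β (lcpFrom 0 (suc k))           ≈⟨ sym (+-identityˡ _) ⟩
      0# + CL f β (lcpFrom 0 (suc k))      ≈⟨ lcpCost-split (suc k) 0 ⟩
      lcpCost (suc k)                      ≤⟨ invariant⇒bound k k<T (invariant k k<T) Y Y-feasible ⟩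
      3 ·ᴿ CL f β Y                        ∎

theorem3p13 : ∀ {c ℓ₁ ℓ₂ : Level} (R : OrderedCommutativeRing c ℓ₁ ℓ₂) →
    let open OrderedCommutativeRing R in
    let open DataCenter R in
    (T m : ℕ) (β : Carrier) (f : CostFns) →
    0# <ᴿ β →
    (∀ t → 1 ≤ t → t ≤ T → NonNeg m (f t)) →
    (∀ t → 1 ≤ t → t ≤ T → Convex m (f t)) →
    (xL xU : ℕ → ℕ) →
    (∀ k → suc k ≤ T → IsXL f β m k (xL (suc k))) →
    (∀ k → suc k ≤ T → IsXU f β m k (xU (suc k))) →
    (Xopt : Vec ℕ T) → IsMinimizer (CL f β) m Xopt →
    CL f β (lcpSchedule xL xU T) ≤ᴿ 3 ·ᴿ CL f β Xopt
-- with no time steps both costs vanish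
theorem3p13 R zero _ _ _ _ _ _ _ _ _ _ [] _ =
  OrderedRingLemmas.·ᴿ-nonneg R 3 (OrderedRingLemmas.≤ᴿ-refl R)
theorem3p13 R (suc k) m β f 0<β nonneg convex xL xU isL isU Xopt (Xopt-feasible , _) =
  lcp-3-competitive k ℕₚ.≤-refl Xopt Xopt-feasible
  where open Analysis.LCP R (suc k) m β f (proj₁ 0<β) nonneg convex xL xU isL isU
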